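{- For all $n \geq 1$, we have $\varphi \circ \psi = \zeta$ as maps $\mathcal{D}_n \to \mathcal{D}_n$.
   Context: A Dyck path of size $n$ is a lattice path of $n$ north steps $(0,1)$ and $n$ east steps $(1,0)$ from $(0,0)$ to $(n,n)$ staying weakly above $y=x$; $\mathcal{D}_n$ is the set of these. For $D \in \mathcal{D}_n$, its area vector $(a_1, \ldots, a_n)$ has $a_i$ equal to the number of full unit squares lying between $D$ and the diagonal $y=x$ whose upper edge lies on the line $y = i$. For a finite set $S = \{x_1 < \cdots < x_n\} \subset \mathbb{R}$, $\preceq_S$ is the partial order on $[n]$ with $i \prec_S j$ iff $x_i + 1 < x_j$; a unit interval poset is a poset isomorphic to some $([n], \preceq_S)$. $\psi$: $\psi(D)$ is the poset on $[n]$ with $i \prec j$ iff either $a_i + 2 \leq a_j$, or $a_i + 1 = a_j$ and $i < j$ (this is a unit interval poset). $\varphi$: given a unit interval poset $P \cong ([n], \preceq_S)$, choose $S$ (possible without changing $\preceq_S$) with $S \cap S^+ = \varnothing$ where $S^+ = \{x+1 : x \in S\}$; write $S \cup S^+ = \{y_1 < \cdots < y_{2n}\}$; $\varphi(P)$ is the Dyck path whose $i$-th step is north if $y_i \in S$ and east otherwise (independent of the choice of $S$). $\zeta$ is the zeta map of $q,t$-Catalan combinatorics: for $D$ with area vector $(a_1,\ldots,a_n)$, $\zeta(D)$ is the path obtained by successively, for $k = 0, 1, 2, \ldots$, scanning $a_1, a_2, \ldots, a_n$ from left to right and appending a north step for each $a_j = k$ and an east step for each $a_j = k-1$, in the order 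encountered.
   Formalization: The finite sets S used to compute φ on a unit interval poset are subsets of ℚ rather than of ℝ. -}

module Defs where

open import Data.Nat as ℕ using (ℕ; zero; suc; _∸_)
open import Data.Nat.Properties as ℕP using ()
open import Data.Fin using (Fin; toℕ)
open import Data.Fin.Permutation using (Permutation′; _⟨$⟩ʳ_)
open import Data.List using (List; []; _∷_; length; map; concatMap; upTo; filter)
open import Data.Product using (Σ; _×_; _,_)
open import Data.Rational as ℚ using (ℚ; 1ℚ)
import Data.Rational.Properties as ℚP
open import Relation.Binary.PropositionalEquality using (_≡_; _≢_)
open import Relation.Nullary using (yes; no; ¬_; does)
open import Data.Bool using (if_then_else_)
open import Function.Bundles using (_⇔_)

-- Lattice paths: N = north step (0,1), E = east step (1,0)

data Step : Set where
  N E : Step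

#N #E : List Step → ℕ
#N []       = 0
#N (N ∷ p)  = suc (#N p)
#N (E ∷ p)  = #N p
#E []       = 0
#E (N ∷ p)  = #E p
#E (E ∷ p)  = suc (#E p)

-- every prefix has at least as many north as east steps
-- (staying weakly above y = x); `ne` = (north − east) surplus so far
AboveFrom : ℕ → List Step → Set
AboveFrom h []      = Data.Unit.⊤ where import Data.Unit
AboveFrom h (N ∷ p) = AboveFrom (suc h) p
AboveFrom zero (E ∷ p)    = Data.Empty.⊥ where import Data.Empty
AboveFrom (suc h) (E ∷ p) = AboveFrom h p

IsDyck : ℕ → List Step → Set
IsDyck n p = (#N p ≡ n) × (#E p ≡ n) × AboveFrom 0 p

Dyck : ℕ → Set
Dyck n = Σ (List Step) (IsDyck n)

-- The i-th north step (1-based) goes from (x_i, i-1) to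
-- (x_i, i), where x_i = number of east steps before it; the full unit
-- squares in row i (upper edge on y = i) between the path and y = x are
-- [x,x+1]×[i-1,i] for x_i ≤ x ≤ i-2, so a_i = (i-1) - x_i.
-- `areaGo k e p`: k = north steps so far, e = east steps so far.

areaGo : ℕ → ℕ → List Step → List ℕ
areaGo k e []      = []
areaGo k e (N ∷ p) = (k ∸ e) ∷ areaGo (suc k) e p
areaGo k e (E ∷ p) = areaGo k (suc e) p

area : List Step → List ℕ
area = areaGo 0 0

-- 0-based lookup with default 0 (only used at indices < length)
at : List ℕ → ℕ → ℕ
at []       _       = 0
at (x ∷ xs) zero    = x
at (x ∷ xs) (suc i) = at xs i

-- ψ(D): strict order on [n] (here Fin n, element i ↔ i+1):
-- i ≺ j iff a_i + 2 ≤ a_j, or a_i + 1 = a_j and i < j.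

ψ< : ∀ {n} → Dyck n → Fin n → Fin n → Set
ψ< (p , _) i j =
  let ai = at (area p) (toℕ i) ; aj = at (area p) (toℕ j) in
  (suc (suc ai) ℕ.≤ aj) Data.Sum.⊎ ((suc ai ≡ aj) × (toℕ i ℕ.< toℕ j))
  where import Data.Sum

-- ζ(D): for k = 0,1,...,n scan a_1..a_n, emitting N for a_j = k and E for
-- a_j = k-1. (All a_j ≤ n-1, so k > n contributes nothing.)

ζstep : ℕ → ℕ → List Step
ζstep k a with a ℕ.≟ k
... | yes _ = N ∷ []
... | no _ with suc a ℕ.≟ k
...   | yes _ = E ∷ []
...   | no _  = []

ζ : ∀ {n} → Dyck n → List Step
ζ {n} (p , _) = concatMap (λ k → concatMap (ζstep k) (area p)) (upTo (suc n))

-- Unit interval posets from finite sets S = {x_1 < ... < x_n} ⊂ ℚ,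
-- given as x : Fin n → ℚ strictly increasing.

StrictlyIncreasing : ∀ {n} → (Fin n → ℚ) → Set
StrictlyIncreasing {n} x = ∀ i j → toℕ i ℕ.< toℕ j → x i ℚ.< x j

Disjoint+ : ∀ {n} → (Fin n → ℚ) → Set
Disjoint+ {n} x = ∀ i j → x i ℚ.+ 1ℚ ≢ x j

S< : ∀ {n} → (Fin n → ℚ) → Fin n → Fin n → Set
S< x i j = x i ℚ.+ 1ℚ ℚ.< x j

IsoToψ : ∀ {n} → (Fin n → ℚ) → Dyck n → Set
IsoToψ {n} x D =
  Σ (Permutation′ n) λ σ → ∀ i j → S< x i j ⇔ ψ< D (σ ⟨$⟩ʳ i) (σ ⟨$⟩ʳ j)

-- Word of S ∪ S⁺ = {y_1 < ... < y_2n}: N if y_i ∈ S, E if y_i ∈ S⁺,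
-- obtained by merging the sorted lists S and S⁺ (ties cannot occur
-- under Disjoint+).
merge : List ℚ → List ℚ → List Step
merge []       ys = map (λ _ → E) ys
merge (x ∷ xs) [] = N ∷ merge xs []
merge (x ∷ xs) (y ∷ ys) =
  if does (x ℚP.<? y) then N ∷ merge xs (y ∷ ys) else E ∷ merge (x ∷ xs) ys

listOf : ∀ {n} → (Fin n → ℚ) → List ℚ
listOf {n} x = Data.List.tabulate x where import Data.List

φword : ∀ {n} → (Fin n → ℚ) → List Step
φword x = merge (listOf x) (map (ℚ._+ 1ℚ) (listOf x))

-- S is an admissible representation of ψ(D) for computing φ(ψ(D))
Admissible : ∀ {n} → Dyck n → (Fin n → ℚ) → Set
Admissible D x = StrictlyIncreasing x × Disjoint+ x × IsoToψ x D

module Submission where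

-- A word in N and E is determined by its number of east steps and, for every column t, the
-- number of its north steps on the line x = t. Both φ(ψ(D)) and ζ(D) have n east steps. In
-- φ the north step of x_j lies in the column counting the i with x_i + 1 < x_j, i.e. the number
-- of predecessors of j; in ζ(D) the north step produced by a_j lies in the column counting the l
-- with (a_l + 1, l) lexicographically before (a_j, j), which is again the number of predecessors
-- of j in ψ(D). The histogram of predecessor counts is invariant under isomorphism, so the two
-- words agree. An admissible S exists because a_j (n + 1) + j encodes that lexicographic order.

open import Defs
open import Data.Empty using (⊥-elim)
open import Data.Fin as Fin using (Fin; toℕ; fromℕ<)
import Data.Fin.Properties as FinP
open import Data.Fin.Permutation using (Permutation′; _⟨$⟩ʳ_; permutation)
open import Data.Integer as ℤ using (ℤ; +<+)
import Data.Integer.Properties as ℤP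
open import Data.Integer.Tactic.RingSolver using (solve-∀)
import Data.Nat.Tactic.RingSolver as ℕSolver
open import Data.List using (List; []; _∷_; _++_; map; length; tabulate; concatMap; applyUpTo; upTo)
import Data.List.Properties as ListP
open import Data.List.Relation.Unary.All as All using (All; []; _∷_)
open import Data.List.Relation.Unary.AllPairs using (AllPairs; []; _∷_)
open import Data.List.Relation.Unary.AllPairs.Properties using (tabulate⁺-<)
open import Data.List.Relation.Unary.Any using (here; there)
open import Data.List.Membership.Propositional using (_∈_)
open import Data.List.Membership.Propositional.Properties using (∈-tabulate⁻)
open import Data.Nat as ℕ using (ℕ; zero; suc; _+_; _*_; _≤_; _<_; z≤n; s≤s)
import Data.Nat.Properties as ℕP
open import Data.Product using (Σ; ∃; _×_; _,_; proj₁; proj₂)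
open import Data.Rational as ℚ using (ℚ; 1ℚ; toℚᵘ; fromℚᵘ)
import Data.Rational.Properties as ℚP
open import Data.Rational.Unnormalised as ℚᵘ using (mkℚᵘ; *≡*; *<*)
import Data.Rational.Unnormalised.Properties as ℚᵘP
open import Data.Sum using (_⊎_; inj₁; inj₂; [_,_]; [_,_]′)
open import Function using (_∘_)
open import Function.Bundles using (_⇔_; mk⇔; Equivalence)
open import Function.Definitions using (Injective)
open import Relation.Binary.Core using (Rel)
open import Relation.Binary.Definitions using (Decidable; tri<; tri≈; tri>)
open import Relation.Binary.PropositionalEquality
  using (_≡_; _≢_; refl; sym; trans; cong; cong₂; subst; subst₂; module ≡-Reasoning)
open import Relation.Nullary using (Dec; yes; no; ¬_)
open import Relation.Nullary.Decidable using (_⊎-dec_; _×-dec_; dec-true; dec-false; toSum)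
open import Algebra.Properties.CommutativeMonoid.Sum ℕP.+-0-commutativeMonoid
  using (sum; sum-syntax; sum-cong-≗; sum-replicate-zero; ∑-distrib-+; ∑-comm; ∑-permute)

open ≡-Reasoning

indicator : ∀ {a} {A : Set a} → Dec A → ℕ
indicator (yes _) = 1
indicator (no _)  = 0

indicator-yes : ∀ {a} {A : Set a} → A → (a? : Dec A) → indicator a? ≡ 1
indicator-yes a (yes _) = refl
indicator-yes a (no ¬a) = ⊥-elim (¬a a)

indicator-no : ∀ {a} {A : Set a} → ¬ A → (a? : Dec A) → indicator a? ≡ 0
indicator-no ¬a (yes a) = ⊥-elim (¬a a)
indicator-no ¬a (no _)  = refl

indicator-cong : ∀ {a b} {A : Set a} {B : Set b} → A ⇔ B →
                 (a? : Dec A) (b? : Dec B) → indicator a? ≡ indicator b?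
indicator-cong A⇔B a? (yes b) = indicator-yes (Equivalence.from A⇔B b) a?
indicator-cong A⇔B a? (no ¬b) = indicator-no (¬b ∘ Equivalence.to A⇔B) a?

δ : ℕ → ℕ → ℕ
δ zero    zero    = 1
δ zero    (suc _) = 0
δ (suc _) zero    = 0
δ (suc m) (suc n) = δ m n

δ-refl : ∀ m → δ m m ≡ 1
δ-refl zero    = refl
δ-refl (suc m) = δ-refl m

δ-≢ : ∀ {m n} → m ≢ n → δ m n ≡ 0
δ-≢ {zero}  {zero}  m≢n = ⊥-elim (m≢n refl)
δ-≢ {zero}  {suc n} _   = refl
δ-≢ {suc m} {zero}  _   = refl
δ-≢ {suc m} {suc n} m≢n = δ-≢ (m≢n ∘ cong suc)

[_<_] : ℕ → ℕ → ℕ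
[ _     < zero  ] = 0
[ zero  < suc _ ] = 1
[ suc m < suc n ] = [ m < n ]

[<]-yes : ∀ {m n} → m < n → [ m < n ] ≡ 1
[<]-yes {zero}  {suc n} _         = refl
[<]-yes {suc m} {suc n} (s≤s m<n) = [<]-yes m<n

[<]-no : ∀ {m n} → ¬ m < n → [ m < n ] ≡ 0
[<]-no {m}     {zero}  _   = refl
[<]-no {zero}  {suc n} m≮n = ⊥-elim (m≮n (s≤s z≤n))
[<]-no {suc m} {suc n} m≮n = [<]-no (m≮n ∘ s≤s)

[<]≤1 : ∀ m n → [ m < n ] ≤ 1
[<]≤1 m       zero    = z≤n
[<]≤1 zero    (suc n) = ℕP.≤-refl
[<]≤1 (suc m) (suc n) = [<]≤1 m n

[<]-monoʳ-≤ : ∀ m {n o} → n ≤ o → [ m < n ] ≤ [ m < o ]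
[<]-monoʳ-≤ m {n} {o} n≤o with m ℕP.<? n
... | yes m<n rewrite [<]-yes m<n | [<]-yes (ℕP.<-≤-trans m<n n≤o) = ℕP.≤-refl
... | no  m≮n rewrite [<]-no m≮n = z≤n

-- ψ< compares (a_i + 1, i) with (a_j, j) lexicographically.
lex-indicator : ∀ a b i j (d : Dec (suc a < b ⊎ (suc a ≡ b × i < j))) →
                indicator d ≡ [ suc a < b ] + δ (suc a) b * [ i < j ]
lex-indicator a b i j d with ℕP.<-cmp (suc a) b
... | tri< lt _ _ rewrite [<]-yes lt | δ-≢ (ℕP.<⇒≢ lt) = indicator-yes (inj₁ lt) d
... | tri> _ _ gt rewrite [<]-no (ℕP.<⇒≯ gt) | δ-≢ (ℕP.>⇒≢ gt) =
  indicator-no [ ℕP.<⇒≯ gt , ℕP.>⇒≢ gt ∘ proj₁ ] d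
... | tri≈ _ refl _ rewrite [<]-no (ℕP.<-irrefl {suc a} refl) | δ-refl a with i ℕP.<? j
...   | yes i<j rewrite [<]-yes i<j = indicator-yes (inj₂ (refl , i<j)) d
...   | no  i≮j rewrite [<]-no i≮j = indicator-no [ ℕP.<-irrefl refl , i≮j ∘ proj₂ ] d

∑-mono-≤ : ∀ {n} {f g : Fin n → ℕ} → (∀ i → f i ≤ g i) → sum f ≤ sum g
∑-mono-≤ {zero}  f≤g = z≤n
∑-mono-≤ {suc n} f≤g = ℕP.+-mono-≤ (f≤g Fin.zero) (∑-mono-≤ (f≤g ∘ Fin.suc))

∑-mono-< : ∀ {n} {f g : Fin n → ℕ} → (∀ i → f i ≤ g i) → ∀ j → f j < g j → sum f < sum g
∑-mono-< f≤g Fin.zero    fj<gj = ℕP.+-mono-<-≤ fj<gj (∑-mono-≤ (f≤g ∘ Fin.suc))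
∑-mono-< f≤g (Fin.suc j) fj<gj = ℕP.+-mono-≤-< (f≤g Fin.zero) (∑-mono-< (f≤g ∘ Fin.suc) j fj<gj)

∑-const-1 : ∀ n → ∑[ i < n ] 1 ≡ n
∑-const-1 zero    = refl
∑-const-1 (suc n) = cong suc (∑-const-1 n)

∑< : ℕ → (ℕ → ℕ) → ℕ
∑< n f = ∑[ i < n ] f (toℕ i)

∑<-cong : ∀ n {f g : ℕ → ℕ} → (∀ i → i < n → f i ≡ g i) → ∑< n f ≡ ∑< n g
∑<-cong n f≡g = sum-cong-≗ (λ i → f≡g (toℕ i) (FinP.toℕ<n i))

∑<-+ : ∀ n (f g : ℕ → ℕ) → ∑< n (λ i → f i + g i) ≡ ∑< n f + ∑< n g
∑<-+ n f g = ∑-distrib-+ (f ∘ toℕ {n}) (g ∘ toℕ)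

∑<-comm : ∀ m n (f : ℕ → ℕ → ℕ) → ∑< m (λ i → ∑< n (f i)) ≡ ∑< n (λ j → ∑< m (λ i → f i j))
∑<-comm m n f = ∑-comm (λ (i : Fin m) (j : Fin n) → f (toℕ i) (toℕ j))

∑<-δ : ∀ k v → ∑< k (δ v) ≡ [ v < k ]
∑<-δ zero    v       = refl
∑<-δ (suc k) zero    = cong suc (sum-replicate-zero k)
∑<-δ (suc k) (suc v) = ∑<-δ k v

∑<-δ-select : ∀ n v (g : ℕ → ℕ) → v < n → ∑< n (λ k → δ v k * g k) ≡ g v
∑<-δ-select (suc n) zero    g _ = begin
  g 0 + 0 + ∑< n (λ _ → 0) ≡⟨ cong₂ _+_ (ℕP.+-identityʳ (g 0)) (sum-replicate-zero n) ⟩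
  g 0 + 0                  ≡⟨ ℕP.+-identityʳ (g 0) ⟩
  g 0                      ∎
∑<-δ-select (suc n) (suc v) g (s≤s v<n) = ∑<-δ-select n v (g ∘ suc) v<n

∑<-prefix : ∀ n j (g : ℕ → ℕ) → j ≤ n → ∑< n (λ l → g l * [ l < j ]) ≡ ∑< j g
∑<-prefix n       zero    g _         = trans (∑<-cong n (λ l _ → ℕP.*-zeroʳ (g l))) (sum-replicate-zero n)
∑<-prefix (suc n) (suc j) g (s≤s j≤n) = cong₂ _+_ (ℕP.*-identityʳ (g 0)) (∑<-prefix n j (g ∘ suc) j≤n)

#pred : ∀ {n ℓ} {R : Rel (Fin n) ℓ} → Decidable R → Fin n → ℕ
#pred {n} R? j = ∑[ i < n ] indicator (R? i j)

predHistogram : ∀ {n ℓ} {R : Rel (Fin n) ℓ} → Decidable R → ℕ → ℕ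
predHistogram {n} R? t = ∑[ j < n ] δ (#pred R? j) t

predHistogram-iso : ∀ {n ℓ ℓ′} {R : Rel (Fin n) ℓ} {R′ : Rel (Fin n) ℓ′}
                    (R? : Decidable R) (R′? : Decidable R′) (σ : Permutation′ n) →
                    (∀ i j → R i j ⇔ R′ (σ ⟨$⟩ʳ i) (σ ⟨$⟩ʳ j)) →
                    ∀ t → predHistogram R? t ≡ predHistogram R′? t
predHistogram-iso {n} R? R′? σ R⇔R′ t = begin
  ∑[ k < n ] δ (#pred R? k) t              ≡⟨ sum-cong-≗ (λ k → cong (λ m → δ m t) (#pred-iso k)) ⟩
  ∑[ k < n ] δ (#pred R′? (σ ⟨$⟩ʳ k)) t  ≡⟨ ∑-permute (λ k → δ (#pred R′? k) t) σ ⟨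
  ∑[ k < n ] δ (#pred R′? k) t             ∎
  where
  #pred-iso : ∀ k → #pred R? k ≡ #pred R′? (σ ⟨$⟩ʳ k)
  #pred-iso k = begin
    ∑[ i < n ] indicator (R? i k)                         ≡⟨ sum-cong-≗ (λ i → indicator-cong (R⇔R′ i k) _ _) ⟩
    ∑[ i < n ] indicator (R′? (σ ⟨$⟩ʳ i) (σ ⟨$⟩ʳ k))  ≡⟨ ∑-permute (λ i → indicator (R′? i (σ ⟨$⟩ʳ k))) σ ⟨
    ∑[ i < n ] indicator (R′? i (σ ⟨$⟩ʳ k))             ∎

-- A word over {N, E} read as a lattice path starting on the vertical line x = c;
-- #N-at c w t counts its north steps on the line x = t.
#N-at : ℕ → List Step → ℕ → ℕ
#N-at c []      t = 0
#N-at c (N ∷ w) t = δ c t + #N-at c w t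
#N-at c (E ∷ w) t = #N-at (suc c) w t

#N-at-suc-0 : ∀ c w → #N-at (suc c) w 0 ≡ 0
#N-at-suc-0 c []      = refl
#N-at-suc-0 c (N ∷ w) = #N-at-suc-0 c w
#N-at-suc-0 c (E ∷ w) = #N-at-suc-0 (suc c) w

#N-at-suc : ∀ c w t → #N-at (suc c) w (suc t) ≡ #N-at c w t
#N-at-suc c []      t = refl
#N-at-suc c (N ∷ w) t = cong (δ c t +_) (#N-at-suc c w t)
#N-at-suc c (E ∷ w) t = #N-at-suc (suc c) w t

#N-at-++ : ∀ c u v t → #N-at c (u ++ v) t ≡ #N-at c u t + #N-at (c + #E u) v t
#N-at-++ c []      v t rewrite ℕP.+-identityʳ c = refl
#N-at-++ c (N ∷ u) v t rewrite #N-at-++ c u v t = sym (ℕP.+-assoc (δ c t) _ _)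
#N-at-++ c (E ∷ u) v t rewrite #N-at-++ (suc c) u v t | ℕP.+-suc c (#E u) = refl

#E-++ : ∀ u v → #E (u ++ v) ≡ #E u + #E v
#E-++ []      v = refl
#E-++ (N ∷ u) v = #E-++ u v
#E-++ (E ∷ u) v = cong suc (#E-++ u v)

≡-by-#N-at : ∀ {u v} → #E u ≡ #E v → (∀ t → #N-at 0 u t ≡ #N-at 0 v t) → u ≡ v
≡-by-#N-at {[]}    {[]}    _  _  = refl
≡-by-#N-at {[]}    {N ∷ v} _  eq with eq 0
... | ()
≡-by-#N-at {[]}    {E ∷ v} () _
≡-by-#N-at {N ∷ u} {[]}    _  eq with eq 0
... | ()
≡-by-#N-at {N ∷ u} {N ∷ v} #E≡ eq = cong (N ∷_) (≡-by-#N-at #E≡ (λ t → ℕP.+-cancelˡ-≡ (δ 0 t) _ _ (eq t)))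
≡-by-#N-at {N ∷ u} {E ∷ v} _  eq with trans (eq 0) (#N-at-suc-0 0 v)
... | ()
≡-by-#N-at {E ∷ u} {[]}    () _
≡-by-#N-at {E ∷ u} {N ∷ v} _  eq with trans (sym (#N-at-suc-0 0 u)) (eq 0)
... | ()
≡-by-#N-at {E ∷ u} {E ∷ v} #E≡ eq = cong (E ∷_) (≡-by-#N-at (ℕP.suc-injective #E≡)
  (λ t → trans (sym (#N-at-suc 0 u t)) (trans (eq (suc t)) (#N-at-suc 0 v t))))

∑-over : ∀ {A : Set} → (A → ℕ) → List A → ℕ
∑-over f []       = 0
∑-over f (a ∷ as) = f a + ∑-over f as

∑-over-cong : ∀ {A : Set} {f g : A → ℕ} {as : List A} →
              All (λ a → f a ≡ g a) as → ∑-over f as ≡ ∑-over g as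
∑-over-cong []           = refl
∑-over-cong (fa≡ga ∷ eqs) = cong₂ _+_ fa≡ga (∑-over-cong eqs)

∑-over-tabulate : ∀ {A : Set} {n} (f : A → ℕ) (g : Fin n → A) → ∑-over f (tabulate g) ≡ ∑[ i < n ] f (g i)
∑-over-tabulate {n = zero}  f g = refl
∑-over-tabulate {n = suc n} f g = cong (f (g Fin.zero) +_) (∑-over-tabulate f (g ∘ Fin.suc))

#below : List ℚ → ℚ → ℕ
#below ys a = ∑-over (λ b → indicator (b ℚP.<? a)) ys

#below-none : ∀ {a} ys → All (λ b → ¬ b ℚ.< a) ys → #below ys a ≡ 0
#below-none []       []             = refl
#below-none (b ∷ ys) (b≮a ∷ ys≮a) = cong₂ _+_ (indicator-no b≮a _) (#below-none ys ys≮a)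

merge-< : ∀ {x y : ℚ} {xs ys} → x ℚ.< y → merge (x ∷ xs) (y ∷ ys) ≡ N ∷ merge xs (y ∷ ys)
merge-< {x} {y} x<y rewrite dec-true (x ℚP.<? y) x<y = refl

merge-≮ : ∀ {x y : ℚ} {xs ys} → ¬ x ℚ.< y → merge (x ∷ xs) (y ∷ ys) ≡ E ∷ merge (x ∷ xs) ys
merge-≮ {x} {y} x≮y rewrite dec-false (x ℚP.<? y) x≮y = refl

#E-merge : ∀ xs ys → #E (merge xs ys) ≡ length ys
#E-merge []       []       = refl
#E-merge []       (y ∷ ys) = cong suc (#E-merge [] ys)
#E-merge (x ∷ xs) []       = #E-merge xs []
#E-merge (x ∷ xs) (y ∷ ys) = [
  (λ x<y → trans (cong #E (merge-< {xs = xs} {ys} x<y)) (#E-merge xs (y ∷ ys))) ,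
  (λ x≮y → trans (cong #E (merge-≮ {xs = xs} {ys} x≮y)) (cong suc (#E-merge (x ∷ xs) ys))) ]′
  (toSum (x ℚP.<? y))

#N-at-Es : ∀ c (ys : List ℚ) t → #N-at c (map (λ _ → E) ys) t ≡ 0
#N-at-Es c []       t = refl
#N-at-Es c (_ ∷ ys) t = #N-at-Es (suc c) ys t

#N-at-merge-< : ∀ {c t x y xs ys} → x ℚ.< y → All (y ℚ.≤_) ys →
                #N-at c (merge xs (y ∷ ys)) t ≡ ∑-over (λ a → δ (c + #below (y ∷ ys) a) t) xs →
                #N-at c (merge (x ∷ xs) (y ∷ ys)) t ≡ ∑-over (λ a → δ (c + #below (y ∷ ys) a) t) (x ∷ xs)
#N-at-merge-< {c} {t} {x} {y} {xs} {ys} x<y y≤ys ih = begin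
  #N-at c (merge (x ∷ xs) (y ∷ ys)) t                   ≡⟨ cong (λ w → #N-at c w t) (merge-< {xs = xs} {ys} x<y) ⟩
  δ c t + #N-at c (merge xs (y ∷ ys)) t                 ≡⟨ cong₂ _+_ (cong (λ m → δ m t) (sym x-first)) ih ⟩
  ∑-over (λ a → δ (c + #below (y ∷ ys) a) t) (x ∷ xs)  ∎
  where
  x-first : c + #below (y ∷ ys) x ≡ c
  x-first = trans (cong (c +_) (#below-none (y ∷ ys) (ℚP.<-asym x<y ∷
              All.map (λ y≤b b<x → ℚP.<-asym (ℚP.<-≤-trans x<y y≤b) b<x) y≤ys))) (ℕP.+-identityʳ c)

#N-at-merge-≮ : ∀ {c t x y xs ys} → ¬ x ℚ.< y → x ≢ y → All (x ℚ.≤_) xs →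
                #N-at (suc c) (merge (x ∷ xs) ys) t ≡ ∑-over (λ a → δ (suc c + #below ys a) t) (x ∷ xs) →
                #N-at c (merge (x ∷ xs) (y ∷ ys)) t ≡ ∑-over (λ a → δ (c + #below (y ∷ ys) a) t) (x ∷ xs)
#N-at-merge-≮ {c} {t} {x} {y} {xs} {ys} x≮y x≢y x≤xs ih = begin
  #N-at c (merge (x ∷ xs) (y ∷ ys)) t                    ≡⟨ cong (λ w → #N-at c w t) (merge-≮ {xs = xs} {ys} x≮y) ⟩
  #N-at (suc c) (merge (x ∷ xs) ys) t                    ≡⟨ ih ⟩
  ∑-over (λ a → δ (suc c + #below ys a) t) (x ∷ xs)     ≡⟨ ∑-over-cong (y-before ℚP.≤-refl ∷ All.map y-before x≤xs) ⟩
  ∑-over (λ a → δ (c + #below (y ∷ ys) a) t) (x ∷ xs)   ∎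
  where
  y<x : y ℚ.< x
  y<x with ℚP.<-cmp y x
  ... | tri< y<x _ _ = y<x
  ... | tri≈ _ y≡x _ = ⊥-elim (x≢y (sym y≡x))
  ... | tri> _ _ x<y = ⊥-elim (x≮y x<y)
  y-before : ∀ {a} → x ℚ.≤ a → δ (suc c + #below ys a) t ≡ δ (c + #below (y ∷ ys) a) t
  y-before {a} x≤a rewrite indicator-yes (ℚP.<-≤-trans y<x x≤a) (y ℚP.<? a) =
    cong (λ m → δ m t) (sym (ℕP.+-suc c (#below ys a)))

#N-at-merge : ∀ c t xs ys → AllPairs ℚ._≤_ xs → AllPairs ℚ._≤_ ys →
              (∀ {a b} → a ∈ xs → b ∈ ys → a ≢ b) →
              #N-at c (merge xs ys) t ≡ ∑-over (λ a → δ (c + #below ys a) t) xs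
#N-at-merge c t []       ys _ _ _ = #N-at-Es c ys t
#N-at-merge c t (x ∷ xs) [] (_ ∷ xs↑) _ _ =
  cong₂ _+_ (cong (λ m → δ m t) (sym (ℕP.+-identityʳ c))) (#N-at-merge c t xs [] xs↑ [] (λ _ ()))
#N-at-merge c t (x ∷ xs) (y ∷ ys) (x≤xs ∷ xs↑) (y≤ys ∷ ys↑) disj = [
  (λ x<y → #N-at-merge-< x<y y≤ys
    (#N-at-merge c t xs (y ∷ ys) xs↑ (y≤ys ∷ ys↑) (disj ∘ there))) ,
  (λ x≮y → #N-at-merge-≮ x≮y (disj (here refl) (here refl)) x≤xs
    (#N-at-merge (suc c) t (x ∷ xs) ys (x≤xs ∷ xs↑) ys↑ (λ a∈ → disj a∈ ∘ there))) ]′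
  (toSum (x ℚP.<? y))

S<? : ∀ {n} (x : Fin n → ℚ) → Decidable (S< x)
S<? x i j = (x i ℚ.+ 1ℚ) ℚP.<? x j

#E-φword : ∀ {n} (x : Fin n → ℚ) → #E (φword x) ≡ n
#E-φword x = begin
  #E (φword x)                          ≡⟨ #E-merge (listOf x) _ ⟩
  length (map (ℚ._+ 1ℚ) (listOf x))    ≡⟨ ListP.length-map (ℚ._+ 1ℚ) (listOf x) ⟩
  length (listOf x)                     ≡⟨ ListP.length-tabulate x ⟩
  _                                     ∎

#N-at-φword : ∀ {n} (x : Fin n → ℚ) → StrictlyIncreasing x → Disjoint+ x →
              ∀ t → #N-at 0 (φword x) t ≡ predHistogram (S<? x) t
#N-at-φword {n} x x↑ x+1∉x t = begin
  #N-at 0 (merge xs (map (ℚ._+ 1ℚ) xs)) t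
    ≡⟨ cong (λ ys → #N-at 0 (merge xs ys) t) (ListP.map-tabulate x (ℚ._+ 1ℚ)) ⟩
  #N-at 0 (merge xs ys) t
    ≡⟨ #N-at-merge 0 t xs ys (tabulate⁺-< (ℚP.<⇒≤ ∘ x↑ _ _))
                             (tabulate⁺-< (ℚP.+-monoˡ-≤ 1ℚ ∘ ℚP.<⇒≤ ∘ x↑ _ _)) disjoint ⟩
  ∑-over (λ a → δ (#below ys a) t) xs
    ≡⟨ ∑-over-tabulate (λ a → δ (#below ys a) t) x ⟩
  ∑[ k < n ] δ (#below ys (x k)) t
    ≡⟨ sum-cong-≗ (λ k → cong (λ m → δ m t)
         (∑-over-tabulate (λ b → indicator (b ℚP.<? x k)) (λ i → x i ℚ.+ 1ℚ))) ⟩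
  predHistogram (S<? x) t ∎
  where
  xs = tabulate x
  ys = tabulate (λ i → x i ℚ.+ 1ℚ)
  disjoint : ∀ {a b} → a ∈ xs → b ∈ ys → a ≢ b
  disjoint a∈ b∈ a≡b with ∈-tabulate⁻ a∈ | ∈-tabulate⁻ b∈
  ... | i , refl | j , refl = x+1∉x j i (sym a≡b)

ψ<? : ∀ {n} (D : Dyck n) → Decidable (ψ< D)
ψ<? (p , _) i j = (suc (suc (at (area p) (toℕ i))) ℕP.≤? at (area p) (toℕ j)) ⊎-dec
  ((suc (at (area p) (toℕ i)) ℕP.≟ at (area p) (toℕ j)) ×-dec (toℕ i ℕP.<? toℕ j))

#N-at-ζstep : ∀ k a c t → #N-at c (ζstep k a) t ≡ δ a k * δ c t
#N-at-ζstep k a c t with a ℕ.≟ k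
... | yes refl rewrite δ-refl a = refl
... | no a≢k with suc a ℕ.≟ k
...   | yes refl rewrite δ-≢ a≢k = refl
...   | no _     rewrite δ-≢ a≢k = refl

#E-ζstep : ∀ k a → #E (ζstep k a) ≡ δ (suc a) k
#E-ζstep k a with a ℕ.≟ k
... | yes refl = sym (δ-≢ (ℕP.1+n≢n {a}))
... | no _ with suc a ℕ.≟ k
...   | yes refl = sym (δ-refl a)
...   | no 1+a≢k = sym (δ-≢ 1+a≢k)

ζscan : List ℕ → ℕ → List Step
ζscan A k = concatMap (ζstep k) A

#E-ζscan : ∀ A k → #E (ζscan A k) ≡ ∑< (length A) (λ l → δ (suc (at A l)) k)
#E-ζscan []      k = refl
#E-ζscan (a ∷ A) k = trans (#E-++ (ζstep k a) (ζscan A k)) (cong₂ _+_ (#E-ζstep k a) (#E-ζscan A k))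

#N-at-ζscan : ∀ A k c t → #N-at c (ζscan A k) t ≡
              ∑< (length A) (λ j → δ (at A j) k * δ (c + ∑< j (λ l → δ (suc (at A l)) k)) t)
#N-at-ζscan []      k c t = refl
#N-at-ζscan (a ∷ A) k c t = begin
  #N-at c (ζstep k a ++ ζscan A k) t
    ≡⟨ #N-at-++ c (ζstep k a) (ζscan A k) t ⟩
  #N-at c (ζstep k a) t + #N-at (c + #E (ζstep k a)) (ζscan A k) t
    ≡⟨ cong₂ _+_ (trans (#N-at-ζstep k a c t) (cong (λ m → δ a k * δ m t) (sym (ℕP.+-identityʳ c))))
                 (trans (cong (λ e → #N-at (c + e) (ζscan A k) t) (#E-ζstep k a)) (#N-at-ζscan A k _ t)) ⟩
  δ a k * δ (c + 0) t + ∑< (length A) (λ j → δ (at A j) k * δ (c + δ (suc a) k + ∑< j (λ l → δ (suc (at A l)) k)) t)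
    ≡⟨ cong (δ a k * δ (c + 0) t +_) (∑<-cong (length A) (λ j _ →
         cong (λ m → δ (at A j) k * δ m t) (ℕP.+-assoc c (δ (suc a) k) (∑< j (λ l → δ (suc (at A l)) k))))) ⟩
  ∑< (suc (length A)) (λ j → δ (at (a ∷ A) j) k * δ (c + ∑< j (λ l → δ (suc (at (a ∷ A) l)) k)) t) ∎

#E-concatMap-applyUpTo : ∀ (B : ℕ → List Step) m g →
                      #E (concatMap B (applyUpTo g m)) ≡ ∑< m (λ k → #E (B (g k)))
#E-concatMap-applyUpTo B zero    g = refl
#E-concatMap-applyUpTo B (suc m) g =
  trans (#E-++ (B (g 0)) _) (cong (#E (B (g 0)) +_) (#E-concatMap-applyUpTo B m (g ∘ suc)))

#N-at-concatMap-applyUpTo : ∀ (B : ℕ → List Step) m g c t →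
  #N-at c (concatMap B (applyUpTo g m)) t ≡ ∑< m (λ k → #N-at (c + ∑< k (λ k′ → #E (B (g k′)))) (B (g k)) t)
#N-at-concatMap-applyUpTo B zero    g c t = refl
#N-at-concatMap-applyUpTo B (suc m) g c t = begin
  #N-at c (B (g 0) ++ concatMap B (applyUpTo (g ∘ suc) m)) t
    ≡⟨ #N-at-++ c (B (g 0)) _ t ⟩
  #N-at c (B (g 0)) t + #N-at (c + #E (B (g 0))) (concatMap B (applyUpTo (g ∘ suc) m)) t
    ≡⟨ cong₂ _+_ (cong (λ c′ → #N-at c′ (B (g 0)) t) (sym (ℕP.+-identityʳ c)))
                 (#N-at-concatMap-applyUpTo B m (g ∘ suc) _ t) ⟩
  #N-at (c + 0) (B (g 0)) t + ∑< m (λ k → #N-at (c + #E (B (g 0)) + ∑< k (λ k′ → #E (B (g (suc k′))))) (B (g (suc k))) t)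
    ≡⟨ cong (#N-at (c + 0) (B (g 0)) t +_) (∑<-cong m (λ k _ →
         cong (λ c′ → #N-at c′ (B (g (suc k))) t) (ℕP.+-assoc c (#E (B (g 0))) (∑< k (λ k′ → #E (B (g (suc k′)))))))) ⟩
  ∑< (suc m) (λ k → #N-at (c + ∑< k (λ k′ → #E (B (g k′)))) (B (g k)) t) ∎

#lexBelow : List ℕ → ℕ → ℕ → ℕ → ℕ
#lexBelow A n k j = ∑< n (λ l → [ suc (at A l) < k ] + δ (suc (at A l)) k * [ l < j ])

module _ (A : List ℕ) {n} (length-A : length A ≡ n) (A<n : ∀ j → j < n → at A j < n) where

  private
    #E-scan : ∀ k → #E (ζscan A k) ≡ ∑< n (λ l → δ (suc (at A l)) k)
    #E-scan k = trans (#E-ζscan A k) (cong (λ m → ∑< m (λ l → δ (suc (at A l)) k)) length-A)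

    #E-before-scan : ∀ k → ∑< k (λ k′ → #E (ζscan A k′)) ≡ ∑< n (λ l → [ suc (at A l) < k ])
    #E-before-scan k = begin
      ∑< k (λ k′ → #E (ζscan A k′))                          ≡⟨ ∑<-cong k (λ k′ _ → #E-scan k′) ⟩
      ∑< k (λ k′ → ∑< n (λ l → δ (suc (at A l)) k′))        ≡⟨ ∑<-comm k n (λ k′ l → δ (suc (at A l)) k′) ⟩
      ∑< n (λ l → ∑< k (δ (suc (at A l))))                  ≡⟨ ∑<-cong n (λ l _ → ∑<-δ k (suc (at A l))) ⟩
      ∑< n (λ l → [ suc (at A l) < k ])                     ∎

    column : ∀ k j → j < n →
             ∑< k (λ k′ → #E (ζscan A k′)) + ∑< j (λ l → δ (suc (at A l)) k) ≡ #lexBelow A n k j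
    column k j j<n = begin
      ∑< k (λ k′ → #E (ζscan A k′)) + ∑< j (λ l → δ (suc (at A l)) k)
        ≡⟨ cong₂ _+_ (#E-before-scan k) (sym (∑<-prefix n j (λ l → δ (suc (at A l)) k) (ℕP.<⇒≤ j<n))) ⟩
      ∑< n (λ l → [ suc (at A l) < k ]) + ∑< n (λ l → δ (suc (at A l)) k * [ l < j ])
        ≡⟨ ∑<-+ n (λ l → [ suc (at A l) < k ]) (λ l → δ (suc (at A l)) k * [ l < j ]) ⟨
      #lexBelow A n k j ∎

  #N-at-ζscans : ∀ t → #N-at 0 (concatMap (ζscan A) (upTo (suc n))) t ≡ ∑< n (λ j → δ (#lexBelow A n (at A j) j) t)
  #N-at-ζscans t = begin
    #N-at 0 (concatMap (ζscan A) (upTo (suc n))) t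
      ≡⟨ #N-at-concatMap-applyUpTo (ζscan A) (suc n) (λ k → k) 0 t ⟩
    ∑< (suc n) (λ k → #N-at (∑< k (λ k′ → #E (ζscan A k′))) (ζscan A k) t)
      ≡⟨ ∑<-cong (suc n) (λ k _ →
           trans (#N-at-ζscan A k (∑< k (λ k′ → #E (ζscan A k′))) t) (by-column k)) ⟩
    ∑< (suc n) (λ k → ∑< n (λ j → δ (at A j) k * δ (#lexBelow A n k j) t))
      ≡⟨ ∑<-comm (suc n) n (λ k j → δ (at A j) k * δ (#lexBelow A n k j) t) ⟩
    ∑< n (λ j → ∑< (suc n) (λ k → δ (at A j) k * δ (#lexBelow A n k j) t))
      ≡⟨ ∑<-cong n (λ j j<n → ∑<-δ-select (suc n) (at A j) (λ k → δ (#lexBelow A n k j) t)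
                                            (ℕP.m≤n⇒m≤1+n (A<n j j<n))) ⟩
    ∑< n (λ j → δ (#lexBelow A n (at A j) j) t) ∎
    where
    by-column : ∀ k →
      ∑< (length A) (λ j → δ (at A j) k * δ (∑< k (λ k′ → #E (ζscan A k′)) + ∑< j (λ l → δ (suc (at A l)) k)) t)
        ≡ ∑< n (λ j → δ (at A j) k * δ (#lexBelow A n k j) t)
    by-column k rewrite length-A = ∑<-cong n (λ j j<n → cong (λ m → δ (at A j) k * δ m t) (column k j j<n))

  #E-ζscans : #E (concatMap (ζscan A) (upTo (suc n))) ≡ n
  #E-ζscans = begin
    #E (concatMap (ζscan A) (upTo (suc n)))               ≡⟨ #E-concatMap-applyUpTo (ζscan A) (suc n) (λ k → k) ⟩
    ∑< (suc n) (λ k → #E (ζscan A k))                      ≡⟨ #E-before-scan (suc n) ⟩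
    ∑< n (λ l → [ suc (at A l) < suc n ])                  ≡⟨ ∑<-cong n (λ l l<n → [<]-yes (s≤s (A<n l l<n))) ⟩
    ∑< n (λ _ → 1)                                          ≡⟨ ∑-const-1 n ⟩
    n                                                       ∎

length-areaGo : ∀ k e p → length (areaGo k e p) ≡ #N p
length-areaGo k e []      = refl
length-areaGo k e (N ∷ p) = cong suc (length-areaGo (suc k) e p)
length-areaGo k e (E ∷ p) = length-areaGo k (suc e) p

areaGo-≤ : ∀ k e p j → at (areaGo k e p) j ≤ k + j
areaGo-≤ k e []      j       = z≤n
areaGo-≤ k e (N ∷ p) zero    = ℕP.≤-trans (ℕP.m∸n≤m k e) (ℕP.m≤m+n k 0)
areaGo-≤ k e (N ∷ p) (suc j) = subst (at (areaGo (suc k) e p) j ≤_) (sym (ℕP.+-suc k j)) (areaGo-≤ (suc k) e p j)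
areaGo-≤ k e (E ∷ p) j       = areaGo-≤ k (suc e) p j

length-area : ∀ {n} (D : Dyck n) → length (area (proj₁ D)) ≡ n
length-area (p , #N≡n , _) = trans (length-areaGo 0 0 p) #N≡n

area<n : ∀ {n} (D : Dyck n) j → j < n → at (area (proj₁ D)) j < n
area<n (p , _) j = ℕP.≤-<-trans (areaGo-≤ 0 0 p j)

#E-ζ : ∀ {n} (D : Dyck n) → #E (ζ D) ≡ n
#E-ζ D = #E-ζscans (area (proj₁ D)) (length-area D) (area<n D)

#N-at-ζ : ∀ {n} (D : Dyck n) t → #N-at 0 (ζ D) t ≡ predHistogram (ψ<? D) t
#N-at-ζ {n} D t = begin
  #N-at 0 (ζ D) t
    ≡⟨ #N-at-ζscans A (length-area D) (area<n D) t ⟩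
  ∑< n (λ j → δ (#lexBelow A n (at A j) j) t)
    ≡⟨ sum-cong-≗ (λ j → cong (λ m → δ m t) (sum-cong-≗ (λ i →
         lex-indicator _ _ (toℕ i) (toℕ j) (ψ<? D i j)))) ⟨
  predHistogram (ψ<? D) t ∎
  where A = area (proj₁ D)

φword≡ζ : ∀ {n} (D : Dyck n) (x : Fin n → ℚ) → Admissible D x → φword x ≡ ζ D
φword≡ζ D x (x↑ , x+1∉x , σ , S<⇔ψ<) = ≡-by-#N-at (trans (#E-φword x) (sym (#E-ζ D))) λ t → begin
  #N-at 0 (φword x) t        ≡⟨ #N-at-φword x x↑ x+1∉x t ⟩
  predHistogram (S<? x) t    ≡⟨ predHistogram-iso (S<? x) (ψ<? D) σ S<⇔ψ< t ⟩
  predHistogram (ψ<? D) t    ≡⟨ #N-at-ζ D t ⟨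
  #N-at 0 (ζ D) t            ∎

lex-< : ∀ {d a b i j} → i < d → a < b ⊎ (a ≡ b × i < j) → a * d + i < b * d + j
lex-< {d} {a} {b} {i} {j} i<d (inj₁ a<b) = ℕP.<-≤-trans (ℕP.+-monoʳ-< (a * d) i<d)
  (subst (_≤ b * d + j) (ℕP.+-comm d (a * d)) (ℕP.≤-trans (ℕP.*-monoˡ-≤ d a<b) (ℕP.m≤m+n (b * d) j)))
lex-< {d} {a} _ (inj₂ (refl , i<j)) = ℕP.+-monoʳ-< (a * d) i<j

lex-<⁻ : ∀ {d a b i j} → j < d → a * d + i < b * d + j → a < b ⊎ (a ≡ b × i < j)
lex-<⁻ {d} {a} {b} {i} {j} j<d lt with ℕP.<-cmp a b
... | tri< a<b _ _ = inj₁ a<b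
... | tri≈ _ refl _ = inj₂ (refl , ℕP.+-cancelˡ-< (a * d) i j lt)
... | tri> _ _ b<a = ⊥-elim (ℕP.<-asym lt (lex-< j<d (inj₁ b<a)))

lex-injective : ∀ {d a b i j} → i < d → j < d → a * d + i ≡ b * d + j → a ≡ b × i ≡ j
lex-injective {d} {a} {b} {i} {j} i<d j<d eq with ℕP.<-cmp a b
... | tri< a<b _ _ = ⊥-elim (ℕP.<⇒≢ (lex-< i<d (inj₁ a<b)) eq)
... | tri≈ _ refl _ = refl , ℕP.+-cancelˡ-≡ (a * d) i j eq
... | tri> _ _ b<a = ⊥-elim (ℕP.<⇒≢ (lex-< j<d (inj₁ b<a)) (sym eq))

injective⇒surjective : ∀ {n} (f : Fin n → Fin n) → Injective _≡_ _≡_ f → ∀ k → ∃ λ j → f j ≡ k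
injective⇒surjective f f-inj k with FinP.any? (λ j → f j FinP.≟ k)
... | yes hit = hit
injective⇒surjective {suc n} f f-inj k | no miss = ⊥-elim (ℕP.<-irrefl refl (FinP.injective⇒≤ f-inj′))
  where
  k≢f : ∀ j → k ≢ f j
  k≢f j k≡fj = miss (j , sym k≡fj)
  f-inj′ : Injective _≡_ _≡_ (λ j → Fin.punchOut (k≢f j))
  f-inj′ {i} {j} eq = f-inj (FinP.punchOut-injective (k≢f i) (k≢f j) eq)

module _ {n} (κ : Fin n → ℕ) (κ-injective : Injective _≡_ _≡_ κ) where

  private
    rank : Fin n → ℕ
    rank j = ∑[ l < n ] [ κ l < κ j ]

    [κ<κ]-irrefl : ∀ j → [ κ j < κ j ] ≡ 0
    [κ<κ]-irrefl j = [<]-no (ℕP.<-irrefl {κ j} refl)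

    rank<n : ∀ j → rank j < n
    rank<n j = subst (rank j <_) (∑-const-1 n)
      (∑-mono-< (λ l → [<]≤1 (κ l) (κ j)) j (subst (_< 1) (sym ([κ<κ]-irrefl j)) (s≤s z≤n)))

    rank-mono-≤ : ∀ {i j} → κ i ≤ κ j → rank i ≤ rank j
    rank-mono-≤ κi≤κj = ∑-mono-≤ (λ l → [<]-monoʳ-≤ (κ l) κi≤κj)

    rank-mono-< : ∀ {i j} → κ i < κ j → rank i < rank j
    rank-mono-< {i} {j} κi<κj = ∑-mono-< (λ l → [<]-monoʳ-≤ (κ l) (ℕP.<⇒≤ κi<κj)) i
      (subst₂ _<_ (sym ([κ<κ]-irrefl i)) (sym ([<]-yes κi<κj)) (s≤s z≤n))

    rank-injective : ∀ {i j} → rank i ≡ rank j → i ≡ j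
    rank-injective {i} {j} eq with ℕP.<-cmp (κ i) (κ j)
    ... | tri< κi<κj _ _ = ⊥-elim (ℕP.<⇒≢ (rank-mono-< κi<κj) eq)
    ... | tri≈ _ κi≡κj _ = κ-injective κi≡κj
    ... | tri> _ _ κj<κi = ⊥-elim (ℕP.<⇒≢ (rank-mono-< κj<κi) (sym eq))

    rankFin : Fin n → Fin n
    rankFin j = fromℕ< (rank<n j)

    toℕ-rankFin : ∀ j → toℕ (rankFin j) ≡ rank j
    toℕ-rankFin j = FinP.toℕ-fromℕ< (rank<n j)

    rankFin-injective : Injective _≡_ _≡_ rankFin
    rankFin-injective {i} {j} eq = rank-injective
      (trans (sym (toℕ-rankFin i)) (trans (cong toℕ eq) (toℕ-rankFin j)))

    unrank : Fin n → Fin n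
    unrank k = proj₁ (injective⇒surjective rankFin rankFin-injective k)

    rankFin-unrank : ∀ k → rankFin (unrank k) ≡ k
    rankFin-unrank k = proj₂ (injective⇒surjective rankFin rankFin-injective k)

  sortingPermutation : Σ (Permutation′ n) λ σ → ∀ i j → toℕ i < toℕ j → κ (σ ⟨$⟩ʳ i) < κ (σ ⟨$⟩ʳ j)
  sortingPermutation = σ , sorted
    where
    σ : Permutation′ n
    σ = permutation unrank rankFin (λ j → rankFin-injective (rankFin-unrank (rankFin j))) rankFin-unrank

    rank-unrank : ∀ k → rank (unrank k) ≡ toℕ k
    rank-unrank k = trans (sym (toℕ-rankFin (unrank k))) (cong toℕ (rankFin-unrank k))

    sorted : ∀ i j → toℕ i < toℕ j → κ (unrank i) < κ (unrank j)
    sorted i j i<j with κ (unrank i) ℕP.<? κ (unrank j)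
    ... | yes κi<κj = κi<κj
    ... | no  κi≮κj = ⊥-elim (ℕP.<⇒≱ i<j (subst₂ _≤_ (rank-unrank j) (rank-unrank i)
                        (rank-mono-≤ (ℕP.≮⇒≥ κi≮κj))))

-- m /1+ n is the rational m / (n + 1) (mkℚᵘ takes the denominator minus one).
_/1+_ : ℕ → ℕ → ℚ
m /1+ n = fromℚᵘ (mkℚᵘ (ℤ.+ m) n)

module _ {n : ℕ} where

  private
    toℚᵘ-/1+ : ∀ m → toℚᵘ (m /1+ n) ℚᵘ.≃ mkℚᵘ (ℤ.+ m) n
    toℚᵘ-/1+ m = ℚP.toℚᵘ-fromℚᵘ (mkℚᵘ (ℤ.+ m) n)

    ℚᵘ-+1 : ∀ m → mkℚᵘ (ℤ.+ m) n ℚᵘ.+ ℚᵘ.1ℚᵘ ℚᵘ.≃ mkℚᵘ (ℤ.+ (m + suc n)) n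
    ℚᵘ-+1 m = *≡* (trans (cross-multiplied (ℤ.+ m) (ℤ.+ suc n))
                         (sym (cong₂ ℤ._*_ (ℤP.pos-+ m (suc n)) (ℤP.pos-* (suc n) 1))))
      where
      cross-multiplied : ∀ (M D : ℤ) → (M ℤ.* ℤ.+ 1 ℤ.+ ℤ.+ 1 ℤ.* D) ℤ.* D ≡ (M ℤ.+ D) ℤ.* (D ℤ.* ℤ.+ 1)
      cross-multiplied = solve-∀

    ℚᵘ-mono-< : ∀ {m m′} → m < m′ → mkℚᵘ (ℤ.+ m) n ℚᵘ.< mkℚᵘ (ℤ.+ m′) n
    ℚᵘ-mono-< {m} {m′} m<m′ =
      *<* (subst₂ ℤ._<_ (ℤP.pos-* m (suc n)) (ℤP.pos-* m′ (suc n)) (+<+ (ℕP.*-monoˡ-< (suc n) m<m′)))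

    ℚᵘ-cancel-< : ∀ {m m′} → mkℚᵘ (ℤ.+ m) n ℚᵘ.< mkℚᵘ (ℤ.+ m′) n → m < m′
    ℚᵘ-cancel-< {m} {m′} (*<* lt) = ℕP.*-cancelʳ-< (suc n) m m′
      (ℤP.drop‿+<+ (subst₂ ℤ._<_ (sym (ℤP.pos-* m (suc n))) (sym (ℤP.pos-* m′ (suc n))) lt))

  /1+-+1 : ∀ m → m /1+ n ℚ.+ 1ℚ ≡ (m + suc n) /1+ n
  /1+-+1 m = ℚP.toℚᵘ-injective (ℚᵘP.≃-trans (ℚP.toℚᵘ-homo-+ (m /1+ n) 1ℚ)
    (ℚᵘP.≃-trans (ℚᵘP.+-cong (toℚᵘ-/1+ m) ℚᵘP.≃-refl)
    (ℚᵘP.≃-trans (ℚᵘ-+1 m) (ℚᵘP.≃-sym (toℚᵘ-/1+ (m + suc n))))))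

  /1+-mono-< : ∀ {m m′} → m < m′ → m /1+ n ℚ.< m′ /1+ n
  /1+-mono-< {m} {m′} m<m′ = ℚP.toℚᵘ-cancel-<
    (ℚᵘP.<-respˡ-≃ (ℚᵘP.≃-sym (toℚᵘ-/1+ m)) (ℚᵘP.<-respʳ-≃ (ℚᵘP.≃-sym (toℚᵘ-/1+ m′)) (ℚᵘ-mono-< m<m′)))

  /1+-cancel-< : ∀ {m m′} → m /1+ n ℚ.< m′ /1+ n → m < m′
  /1+-cancel-< {m} {m′} lt =
    ℚᵘ-cancel-< (ℚᵘP.<-respˡ-≃ (toℚᵘ-/1+ m) (ℚᵘP.<-respʳ-≃ (toℚᵘ-/1+ m′) (ℚP.toℚᵘ-mono-< lt)))

  /1+-injective : ∀ {m m′} → m /1+ n ≡ m′ /1+ n → m ≡ m′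
  /1+-injective {m} {m′} eq with ℕP.<-cmp m m′
  ... | tri< m<m′ _ _ = ⊥-elim (ℚP.<-irrefl eq (/1+-mono-< m<m′))
  ... | tri≈ _ m≡m′ _ = m≡m′
  ... | tri> _ _ m′<m = ⊥-elim (ℚP.<-irrefl (sym eq) (/1+-mono-< m′<m))

-- Encoding row j of D by κ j = a_j (n + 1) + j turns ψ(D) into the order i ≺ j ⇔ κ i + (n + 1) < κ j,
-- so the values κ j / (n + 1), listed increasingly, represent ψ(D).
module _ {n} (D : Dyck n) where

  private
    a : Fin n → ℕ
    a j = at (area (proj₁ D)) (toℕ j)

    κ : Fin n → ℕ
    κ j = a j * suc n + toℕ j

    toℕ<1+n : ∀ (j : Fin n) → toℕ j < suc n
    toℕ<1+n j = ℕP.m≤n⇒m≤1+n (FinP.toℕ<n j)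

    κ+1+n : ∀ j → κ j + suc n ≡ suc (a j) * suc n + toℕ j
    κ+1+n j = rearrange (a j) (suc n) (toℕ j)
      where
      rearrange : ∀ x d i → x * d + i + d ≡ (d + x * d) + i
      rearrange = ℕSolver.solve-∀

    ψ<⇔κ< : ∀ i j → ψ< D i j ⇔ κ i + suc n < κ j
    ψ<⇔κ< i j = mk⇔ (λ ψij → subst (_< κ j) (sym (κ+1+n i)) (lex-< (toℕ<1+n i) ψij))
                    (λ lt → lex-<⁻ (toℕ<1+n j) (subst (_< κ j) (κ+1+n i) lt))

    κ-injective : Injective _≡_ _≡_ κ
    κ-injective {i} {j} eq = FinP.toℕ-injective (proj₂ (lex-injective {a = a i} {a j} (toℕ<1+n i) (toℕ<1+n j) eq))

    σ : Permutation′ n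
    σ = proj₁ (sortingPermutation κ κ-injective)

    x₀ : Fin n → ℚ
    x₀ k = κ (σ ⟨$⟩ʳ k) /1+ n

    x₀+1 : ∀ k → x₀ k ℚ.+ 1ℚ ≡ (κ (σ ⟨$⟩ʳ k) + suc n) /1+ n
    x₀+1 k = /1+-+1 (κ (σ ⟨$⟩ʳ k))

    x₀-increasing : StrictlyIncreasing x₀
    x₀-increasing i j i<j = /1+-mono-< (proj₂ (sortingPermutation κ κ-injective) i j i<j)

    x₀-disjoint : Disjoint+ x₀
    x₀-disjoint i j eq = ℕP.1+n≢n (trans (proj₁ lex-eq) (cong a (sym (FinP.toℕ-injective (proj₂ lex-eq)))))
      where
      lex-eq : suc (a (σ ⟨$⟩ʳ i)) ≡ a (σ ⟨$⟩ʳ j) × toℕ (σ ⟨$⟩ʳ i) ≡ toℕ (σ ⟨$⟩ʳ j)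
      lex-eq = lex-injective (toℕ<1+n (σ ⟨$⟩ʳ i)) (toℕ<1+n (σ ⟨$⟩ʳ j))
                 (trans (sym (κ+1+n (σ ⟨$⟩ʳ i))) (/1+-injective (trans (sym (x₀+1 i)) eq)))

    S<⇔ψ< : ∀ i j → S< x₀ i j ⇔ ψ< D (σ ⟨$⟩ʳ i) (σ ⟨$⟩ʳ j)
    S<⇔ψ< i j = mk⇔
      (λ lt → Equivalence.from (ψ<⇔κ< _ _) (/1+-cancel-< (subst (ℚ._< x₀ j) (x₀+1 i) lt)))
      (λ ψij → subst (ℚ._< x₀ j) (sym (x₀+1 i)) (/1+-mono-< (Equivalence.to (ψ<⇔κ< _ _) ψij)))

  admissibleRepresentation : Σ (Fin n → ℚ) (Admissible D)
  admissibleRepresentation = x₀ , x₀-increasing , x₀-disjoint , σ , S<⇔ψ<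

theorem4p6 : (n : ℕ) → 1 ≤ n → (D : Dyck n) →
    Σ (Fin n → ℚ) (Admissible D)
      × ((x : Fin n → ℚ) → Admissible D x → φword x ≡ ζ D)
theorem4p6 n _ D = admissibleRepresentation D , φword≡ζ D
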